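{- Let $q=2^t$ with $t$ a positive odd integer, let $\beta\in\mathbb{F}_{q^2}\setminus\mathbb{F}_q$ be a root of $x^2+x+1$, and for a positive integer $k$ let $M_k(x)=(x+\beta+1)^k+(x+\beta)^k$. Let $n,m$ be positive integers with $n\le 3(q-1)$ and $m\le q-1$. Then $$x^{n+3(q-1)+m(q+1)}M_{n+3(q-1)}(x^{q-1})\equiv x^{n+m(q+1)}M_n(x^{q-1})\pmod{x^{q^2}+x},$$ i.e. both sides define the same function on $\mathbb{F}_{q^2}$; and for every positive integer $m'$ with $m'\equiv m\pmod{q-1}$, $$x^{n+m(q+1)}M_n(x)\equiv x^{n+m'(q+1)}M_n(x)\pmod{x^{q^2}+x}.$$ -}

module Defs where

open import Level using (_⊔_)
open import Data.Nat using (ℕ)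
open import Data.Fin using (Fin)
open import Data.Product using (Σ; ∃; _×_)
open import Relation.Nullary using (¬_)
open import Relation.Binary.PropositionalEquality using (_≡_)
open import Algebra.Bundles using (CommutativeRing; Semiring)
import Algebra.Definitions.RawSemiring as RS

module _ {c ℓ} (R : CommutativeRing c ℓ) where
  open CommutativeRing R

  pow : Carrier → ℕ → Carrier
  pow = RS._^_ (Semiring.rawSemiring semiring)

  IsField : Set (c ⊔ ℓ)
  IsField = (¬ (1# ≈ 0#)) × (∀ x → ¬ (x ≈ 0#) → ∃ λ y → (x * y) ≈ 1#)

  HasCardinality : ℕ → Set (c ⊔ ℓ)
  HasCardinality N = Σ (Fin N → Carrier) λ f →
    (∀ i j → f i ≈ f j → i ≡ j) × (∀ x → ∃ λ i → f i ≈ x)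

  M : Carrier → ℕ → Carrier → Carrier
  M β k y = pow (y + β + 1#) k + pow (y + β) k

{-# OPTIONS --safe #-}
module Submission where

-- A field with q² elements, q even, has characteristic 2 and satisfies x^(q²-1) = 1 for x ≠ 0
-- (multiplication by x permutes the nonzero elements). In characteristic 2 the map u ↦ u^q is
-- additive, so β^q is again a root of X²+X+1; being different from β it equals β+1. For x ≠ 0 put
-- y = x^(q-1), so that y·y^q = x^(q²-1) = 1. Then y·(y+β+1)^q = β·(y+β+1) and
-- y·(y+β)^q = (β+1)·(y+β), and since β³ = (β+1)³ = 1 multiplying (y+β+1)^(n+3(q-1)) and
-- (y+β)^(n+3(q-1)) by y³ = x^(3(q-1)) removes the extra 3(q-1): this is the first identity.
-- The second is x^(q²-1) = 1 again, as (q-1)(q+1) = q²-1.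

open import Level using (_⊔_)
open import Defs
open import Data.Nat as ℕ using (ℕ; zero; suc; ∣_-_∣)
import Data.Nat.Properties as ℕₚ
open import Data.Nat.Divisibility using (_∣_; divides; m∣m*n; ∣m⇒∣m*n)
open import Data.Nat.Tactic.RingSolver using (solve-∀)
open import Data.Fin as Fin using (Fin; punchIn)
open import Data.Fin.Properties using (punchInᵢ≢i)
open import Data.Fin.Permutation using (Permutation; permutation; remove; punchIn-permute; _⟨$⟩ʳ_)
open import Data.Vec.Functional using (replicate)
open import Data.Product using (∃; _×_; _,_; proj₁; proj₂)
open import Data.Sum using (inj₁; inj₂)
open import Data.Empty using (⊥-elim)
open import Relation.Nullary using (¬_; yes; no)
open import Relation.Binary.Definitions using (Decidable)
open import Relation.Binary.PropositionalEquality as ≡ using (_≡_)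
open import Algebra.Bundles using (CommutativeRing)
import Algebra.Properties.CommutativeMonoid.Sum as ProductProperties

module RingProperties {c ℓ} (R : CommutativeRing c ℓ) where
  open CommutativeRing R
  open import Algebra.Properties.Semiring.Exp semiring
  open import Algebra.Properties.CommutativeSemiring.Exp commutativeSemiring using (^-distrib-*)
  open import Relation.Binary.Reasoning.Setoid setoid
  open ProductProperties *-commutativeMonoid public
    using () renaming (sum to ∏; sum-permute to ∏-permute; ∑-distrib-+ to ∏-distrib-*; sum-cong-≋ to ∏-cong; sum-replicate to ∏-replicate)

  1^n≈1 : ∀ n → 1# ^ n ≈ 1#
  1^n≈1 zero    = refl
  1^n≈1 (suc n) = trans (*-identityˡ _) (1^n≈1 n)

  x≈0⇒x^[1+n]≈0 : ∀ {x} n → x ≈ 0# → x ^ suc n ≈ 0#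
  x≈0⇒x^[1+n]≈0 n x≈0 = trans (*-congʳ x≈0) (zeroˡ _)

  ^-scale : ∀ {u d a} → u * a ≈ d * a → ∀ k → u ^ k * a ≈ d ^ k * a
  ^-scale ua≈da zero    = refl
  ^-scale {u} {d} {a} ua≈da (suc k) = begin
    (u * u ^ k) * a  ≈⟨ *-assoc u _ a ⟩
    u * (u ^ k * a)  ≈⟨ *-congˡ (^-scale ua≈da k) ⟩
    u * (d ^ k * a)  ≈⟨ x∙yz≈y∙xz u _ a ⟩
    d ^ k * (u * a)  ≈⟨ *-congˡ ua≈da ⟩
    d ^ k * (d * a)  ≈⟨ x∙yz≈y∙xz _ d a ⟩
    d * (d ^ k * a)  ≈⟨ *-assoc d _ a ⟨
    (d * d ^ k) * a  ∎
    where open import Algebra.Properties.CommutativeSemigroup *-commutativeSemigroup using (x∙yz≈y∙xz)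

  -- y·a^Q acts on multiples of a as d, so (y·a^Q)^k acts as d^k = 1.
  y^k*a^[1+n+k*Q]≈a^[1+n] : ∀ {y a d} Q k → y * a ^ suc Q ≈ d * a → d ^ k ≈ 1# →
                            ∀ n → y ^ k * a ^ (suc n ℕ.+ k ℕ.* Q) ≈ a ^ suc n
  y^k*a^[1+n+k*Q]≈a^[1+n] {y} {a} {d} Q k ya^q≈da d^k≈1 n = begin
    y ^ k * a ^ (suc n ℕ.+ k ℕ.* Q)      ≈⟨ *-congˡ (^-homo-* a (suc n) (k ℕ.* Q)) ⟩
    y ^ k * (a * a ^ n * a ^ (k ℕ.* Q))  ≈⟨ *-congˡ (*-congˡ (^-congʳ a (ℕₚ.*-comm k Q))) ⟩
    y ^ k * (a * a ^ n * a ^ (Q ℕ.* k))  ≈⟨ *-congˡ (*-congˡ (^-assocʳ a Q k)) ⟨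
    y ^ k * (a * a ^ n * (a ^ Q) ^ k)    ≈⟨ solve 4 (λ Y a A W → Y :* (a :* A :* W) := (Y :* W) :* a :* A) refl (y ^ k) a (a ^ n) ((a ^ Q) ^ k) ⟩
    y ^ k * (a ^ Q) ^ k * a * a ^ n      ≈⟨ *-congʳ (*-congʳ (^-distrib-* y (a ^ Q) k)) ⟨
    (y * a ^ Q) ^ k * a * a ^ n          ≈⟨ *-congʳ (^-scale (trans (*-assoc y _ a) (trans (*-congˡ (*-comm _ a)) ya^q≈da)) k) ⟩
    d ^ k * a * a ^ n                    ≈⟨ *-congʳ (trans (*-congʳ d^k≈1) (*-identityˡ a)) ⟩
    a * a ^ n                            ∎
    where open import Algebra.Solver.Ring.NaturalCoefficients.Default commutativeSemiring

  ∏-scaled-permutation : ∀ {n x} (g : Fin n → Carrier) (ρ : Permutation n n) →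
                         (∀ j → g (ρ ⟨$⟩ʳ j) ≈ x * g j) → x ^ n * ∏ g ≈ ∏ g
  ∏-scaled-permutation {n} {x} g ρ g∘ρ≈x*g = begin
    x ^ n * ∏ g                  ≈⟨ *-congʳ (∏-replicate n) ⟨
    ∏ (replicate n x) * ∏ g      ≈⟨ ∏-distrib-* (replicate n x) g ⟨
    ∏ (λ j → x * g j)            ≈⟨ ∏-cong g∘ρ≈x*g ⟨
    ∏ (λ j → g (ρ ⟨$⟩ʳ j))       ≈⟨ ∏-permute g ρ ⟨
    ∏ g                          ∎

  AdditivePower : ℕ → Set (c ⊔ ℓ)
  AdditivePower p = ∀ x y → (x + y) ^ p ≈ x ^ p + y ^ p

  additive⇒0^p≈0 : ∀ {p} → AdditivePower p → 0# ^ p ≈ 0#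
  additive⇒0^p≈0 {p} additive = x+x≈x⇒x≈0 (0# ^ p) (begin
    0# ^ p + 0# ^ p  ≈⟨ additive 0# 0# ⟨
    (0# + 0#) ^ p    ≈⟨ ^-congˡ p (+-identityʳ 0#) ⟩
    0# ^ p           ∎)
    where open import Algebra.Properties.Ring ring using (x+x≈x⇒x≈0)

HasCharacteristicTwo : ∀ {c ℓ} → CommutativeRing c ℓ → Set ℓ
HasCharacteristicTwo R = 1# + 1# ≈ 0#
  where open CommutativeRing R

module CharacteristicTwo {c ℓ} (R : CommutativeRing c ℓ) (1+1≈0 : HasCharacteristicTwo R) where
  open CommutativeRing R
  open RingProperties R
  open import Algebra.Properties.Semiring.Exp semiring
  open import Algebra.Solver.Ring.NaturalCoefficients.Default commutativeSemiring
  open import Relation.Binary.Reasoning.Setoid setoid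

  x+x≈0 : ∀ x → x + x ≈ 0#
  x+x≈0 x = begin
    x + x            ≈⟨ +-cong (*-identityʳ x) (*-identityʳ x) ⟨
    x * 1# + x * 1#  ≈⟨ distribˡ x 1# 1# ⟨
    x * (1# + 1#)    ≈⟨ *-congˡ 1+1≈0 ⟩
    x * 0#           ≈⟨ zeroʳ x ⟩
    0#               ∎

  -- The semiring solver cannot use 1 + 1 ≈ 0, so identities are solved up to a doubled term.
  x≈y+[z+z]⇒x≈y : ∀ {x y} z → x ≈ y + (z + z) → x ≈ y
  x≈y+[z+z]⇒x≈y {x} {y} z x≈y+2z = begin
    x            ≈⟨ x≈y+2z ⟩
    y + (z + z)  ≈⟨ +-congˡ (x+x≈0 z) ⟩
    y + 0#       ≈⟨ +-identityʳ y ⟩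
    y            ∎

  x+y≈0⇒x≈y : ∀ {x y} → x + y ≈ 0# → x ≈ y
  x+y≈0⇒x≈y {x} {y} x+y≈0 = sym (x≈y+[z+z]⇒x≈y x (begin
    y            ≈⟨ +-identityˡ y ⟨
    0# + y       ≈⟨ +-congʳ x+y≈0 ⟨
    (x + y) + y  ≈⟨ solve 2 (λ x y → (x :+ y) :+ y := x :+ (y :+ y)) refl x y ⟩
    x + (y + y)  ≈⟨ +-congˡ (x+x≈0 y) ⟩
    x + 0#       ≈⟨ +-congˡ (x+x≈0 x) ⟨
    x + (x + x)  ∎))

  x+1+1≈x : ∀ x → x + 1# + 1# ≈ x
  x+1+1≈x x = trans (+-assoc x 1# 1#) (trans (+-congˡ 1+1≈0) (+-identityʳ x))

  [x+y]²≈x²+y² : ∀ x y → (x + y) ^ 2 ≈ x ^ 2 + y ^ 2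
  [x+y]²≈x²+y² x y = x≈y+[z+z]⇒x≈y (x * y)
    (solve 2 (λ x y → (x :+ y) :^ 2 := (x :^ 2 :+ y :^ 2) :+ (x :* y :+ x :* y)) refl x y)

  frobenius : ∀ k → AdditivePower (2 ℕ.^ k)
  frobenius zero    x y = distribʳ 1# x y
  frobenius (suc k) x y = begin
    (x + y) ^ (2 ℕ.* 2 ℕ.^ k)                  ≈⟨ ^-assocʳ (x + y) 2 (2 ℕ.^ k) ⟨
    ((x + y) ^ 2) ^ (2 ℕ.^ k)                  ≈⟨ ^-congˡ (2 ℕ.^ k) ([x+y]²≈x²+y² x y) ⟩
    (x ^ 2 + y ^ 2) ^ (2 ℕ.^ k)                ≈⟨ frobenius k (x ^ 2) (y ^ 2) ⟩
    (x ^ 2) ^ (2 ℕ.^ k) + (y ^ 2) ^ (2 ℕ.^ k)  ≈⟨ +-cong (^-assocʳ x 2 (2 ℕ.^ k)) (^-assocʳ y 2 (2 ℕ.^ k)) ⟩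
    x ^ (2 ℕ.* 2 ℕ.^ k) + y ^ (2 ℕ.* 2 ℕ.^ k)  ∎

  RootOfX²+X+1 : Carrier → Set ℓ
  RootOfX²+X+1 x = x ^ 2 + x + 1# ≈ 0#

  root⇒x²+x≈1 : ∀ {x} → RootOfX²+X+1 x → x ^ 2 + x ≈ 1#
  root⇒x²+x≈1 = x+y≈0⇒x≈y

  root⇒x²≈x+1 : ∀ {x} → RootOfX²+X+1 x → x ^ 2 ≈ x + 1#
  root⇒x²≈x+1 {x} root = x+y≈0⇒x≈y (trans (sym (+-assoc (x ^ 2) x 1#)) root)

  root⇒x³≈1 : ∀ {x} → RootOfX²+X+1 x → x ^ 3 ≈ 1#
  root⇒x³≈1 {x} root = begin
    x * x ^ 2     ≈⟨ *-congˡ (root⇒x²≈x+1 root) ⟩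
    x * (x + 1#)  ≈⟨ solve 1 (λ x → x :* (x :+ con 1) := x :^ 2 :+ x) refl x ⟩
    x ^ 2 + x     ≈⟨ root⇒x²+x≈1 root ⟩
    1#            ∎

  root⇒[x+1]-root : ∀ {x} → RootOfX²+X+1 x → RootOfX²+X+1 (x + 1#)
  root⇒[x+1]-root {x} root = begin
    (x + 1#) ^ 2 + (x + 1#) + 1#  ≈⟨ x≈y+[z+z]⇒x≈y (x + 1#) (solve 1 (λ x → (x :+ con 1) :^ 2 :+ (x :+ con 1) :+ con 1 := (x :^ 2 :+ x :+ con 1) :+ ((x :+ con 1) :+ (x :+ con 1))) refl x) ⟩
    x ^ 2 + x + 1#                ≈⟨ root ⟩
    0#                            ∎

  module _ (p : ℕ) (additive : AdditivePower p) where

    root⇒x^p-root : ∀ {x} → RootOfX²+X+1 x → RootOfX²+X+1 (x ^ p)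
    root⇒x^p-root {x} root = begin
      (x ^ p) ^ 2 + x ^ p + 1#      ≈⟨ +-cong (+-congʳ x²^p≈x^p²) (1^n≈1 p) ⟨
      (x ^ 2) ^ p + x ^ p + 1# ^ p  ≈⟨ +-congʳ (additive (x ^ 2) x) ⟨
      (x ^ 2 + x) ^ p + 1# ^ p      ≈⟨ additive (x ^ 2 + x) 1# ⟨
      (x ^ 2 + x + 1#) ^ p          ≈⟨ ^-congˡ p root ⟩
      0# ^ p                        ≈⟨ additive⇒0^p≈0 {p} additive ⟩
      0#                            ∎
      where
      x²^p≈x^p² : (x ^ 2) ^ p ≈ (x ^ p) ^ 2
      x²^p≈x^p² = trans (^-assocʳ x 2 p) (trans (^-congʳ x (ℕₚ.*-comm 2 p)) (sym (^-assocʳ x p 2)))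

    y*[y+z]^p≈[z+1]*[y+z] : ∀ {y z} → y * y ^ p ≈ 1# → RootOfX²+X+1 z → z ^ p ≈ z + 1# →
                            y * (y + z) ^ p ≈ (z + 1#) * (y + z)
    y*[y+z]^p≈[z+1]*[y+z] {y} {z} y*y^p≈1 root z^p≈z+1 = begin
      y * (y + z) ^ p           ≈⟨ *-congˡ (additive y z) ⟩
      y * (y ^ p + z ^ p)       ≈⟨ *-congˡ (+-congˡ z^p≈z+1) ⟩
      y * (y ^ p + (z + 1#))    ≈⟨ distribˡ y _ _ ⟩
      y * y ^ p + y * (z + 1#)  ≈⟨ +-congʳ y*y^p≈1 ⟩
      1# + y * (z + 1#)         ≈⟨ +-congʳ (root⇒x²+x≈1 root) ⟨
      z ^ 2 + z + y * (z + 1#)  ≈⟨ solve 2 (λ y z → z :^ 2 :+ z :+ y :* (z :+ con 1) := (z :+ con 1) :* (y :+ z)) refl y z ⟩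
      (z + 1#) * (y + z)        ∎

module FieldProperties {c ℓ} (𝔽 : CommutativeRing c ℓ) (isField : IsField 𝔽) where
  open CommutativeRing 𝔽
  open RingProperties 𝔽
  open import Relation.Binary.Reasoning.Setoid setoid

  1≉0 : ¬ 1# ≈ 0#
  1≉0 = proj₁ isField

  *-cancelʳ-nonzero : ∀ {x y z} → ¬ z ≈ 0# → x * z ≈ y * z → x ≈ y
  *-cancelʳ-nonzero {x} {y} {z} z≉0 xz≈yz with proj₂ isField z z≉0
  ... | z⁻¹ , zz⁻¹≈1 = begin
    x               ≈⟨ *-identityʳ x ⟨
    x * 1#          ≈⟨ *-congˡ zz⁻¹≈1 ⟨
    x * (z * z⁻¹)   ≈⟨ *-assoc x z z⁻¹ ⟨
    (x * z) * z⁻¹   ≈⟨ *-congʳ xz≈yz ⟩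
    (y * z) * z⁻¹   ≈⟨ *-assoc y z z⁻¹ ⟩
    y * (z * z⁻¹)   ≈⟨ *-congˡ zz⁻¹≈1 ⟩
    y * 1#          ≈⟨ *-identityʳ y ⟩
    y               ∎

  x*y≈0⇒y≈0 : ∀ {x y} → ¬ x ≈ 0# → x * y ≈ 0# → y ≈ 0#
  x*y≈0⇒y≈0 {x} {y} x≉0 xy≈0 = *-cancelʳ-nonzero x≉0 (trans (*-comm y x) (trans xy≈0 (sym (zeroˡ x))))

  ∏-nonzero : ∀ {n} (g : Fin n → Carrier) → (∀ i → ¬ g i ≈ 0#) → ¬ ∏ g ≈ 0#
  ∏-nonzero {zero}  g g≉0 = 1≉0
  ∏-nonzero {suc n} g g≉0 ∏g≈0 =
    ∏-nonzero (λ i → g (Fin.suc i)) (λ i → g≉0 (Fin.suc i))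
      (x*y≈0⇒y≈0 (g≉0 Fin.zero) ∏g≈0)

  module _ (1+1≈0 : HasCharacteristicTwo 𝔽) where
    open CharacteristicTwo 𝔽 1+1≈0
    open import Algebra.Properties.Semiring.Exp semiring using (_^_)
    open import Algebra.Solver.Ring.NaturalCoefficients.Default commutativeSemiring

    distinct-roots⇒y≈x+1 : ∀ {x y} → RootOfX²+X+1 x → RootOfX²+X+1 y → ¬ y ≈ x → y ≈ x + 1#
    distinct-roots⇒y≈x+1 {x} {y} x-root y-root y≉x =
      x+y≈0⇒x≈y (trans (sym (+-assoc y x 1#)) (x*y≈0⇒y≈0 y+x≉0 product≈0))
      where
      y+x≉0 : ¬ y + x ≈ 0#
      y+x≉0 y+x≈0 = y≉x (x+y≈0⇒x≈y y+x≈0)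

      product≈0 : (y + x) * (y + x + 1#) ≈ 0#
      product≈0 = begin
        (y + x) * (y + x + 1#)     ≈⟨ x≈y+[z+z]⇒x≈y (y * x) (solve 2 (λ y x → (y :+ x) :* (y :+ x :+ con 1) := (y :^ 2 :+ y) :+ (x :^ 2 :+ x) :+ (y :* x :+ y :* x)) refl y x) ⟩
        (y ^ 2 + y) + (x ^ 2 + x)  ≈⟨ +-cong (root⇒x²+x≈1 y-root) (root⇒x²+x≈1 x-root) ⟩
        1# + 1#                    ≈⟨ 1+1≈0 ⟩
        0#                         ∎

module FiniteField {c ℓ} (𝔽 : CommutativeRing c ℓ) (isField : IsField 𝔽) (n : ℕ) (card : HasCardinality 𝔽 (suc n)) where
  open CommutativeRing 𝔽
  open RingProperties 𝔽
  open FieldProperties 𝔽 isField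
  open import Algebra.Properties.Semiring.Exp semiring
  open import Algebra.Properties.Ring ring using (-1*x≈-x; -‿involutive; -‿injective; -0#≈0#)
  open import Relation.Binary.Reasoning.Setoid setoid

  private
    enum : Fin (suc n) → Carrier
    enum = proj₁ card

    enum-injective : ∀ i j → enum i ≈ enum j → i ≡ j
    enum-injective = proj₁ (proj₂ card)

    index : Carrier → Fin (suc n)
    index x = proj₁ (proj₂ (proj₂ card) x)

    enum∘index : ∀ x → enum (index x) ≈ x
    enum∘index x = proj₂ (proj₂ (proj₂ card) x)

  ≈-dec : Decidable _≈_
  ≈-dec x y with index x Fin.≟ index y
  ... | yes ix≡iy = yes (begin
    x               ≈⟨ enum∘index x ⟨
    enum (index x)  ≡⟨ ≡.cong enum ix≡iy ⟩
    enum (index y)  ≈⟨ enum∘index y ⟩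
    y               ∎)
  ... | no ix≢iy = no λ x≈y →
    ix≢iy (enum-injective _ _ (trans (enum∘index x) (trans x≈y (sym (enum∘index y)))))

  scaling : ∀ x y → x * y ≈ 1# → Permutation (suc n) (suc n)
  scaling x y xy≈1 =
    permutation (λ i → index (x * enum i)) (λ i → index (y * enum i)) (undo xy≈1) (undo (trans (*-comm y x) xy≈1))
    where
    undo : ∀ {u v} → u * v ≈ 1# → ∀ i → index (u * enum (index (v * enum i))) ≡ i
    undo {u} {v} uv≈1 i = enum-injective _ _ (begin
      enum (index (u * enum (index (v * enum i))))  ≈⟨ enum∘index _ ⟩
      u * enum (index (v * enum i))                 ≈⟨ *-congˡ (enum∘index _) ⟩
      u * (v * enum i)                              ≈⟨ *-assoc u v _ ⟨
      (u * v) * enum i                              ≈⟨ *-congʳ uv≈1 ⟩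
      1# * enum i                                   ≈⟨ *-identityˡ _ ⟩
      enum i                                        ∎)

  private
    i₀ : Fin (suc n)
    i₀ = index 0#

  units : Fin n → Carrier
  units j = enum (punchIn i₀ j)

  units≉0 : ∀ j → ¬ units j ≈ 0#
  units≉0 j uj≈0 = punchInᵢ≢i i₀ j (enum-injective _ _ (trans uj≈0 (sym (enum∘index 0#))))

  fermat : ∀ {x} → ¬ x ≈ 0# → x ^ n ≈ 1#
  fermat {x} x≉0 with proj₂ isField x x≉0
  ... | y , xy≈1 = *-cancelʳ-nonzero (∏-nonzero units units≉0)
                     (trans (∏-scaled-permutation units (remove i₀ π) units∘ρ≈x*units) (sym (*-identityˡ _)))
    where
    π : Permutation (suc n) (suc n)
    π = scaling x y xy≈1

    π-fixes-i₀ : π ⟨$⟩ʳ i₀ ≡ i₀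
    π-fixes-i₀ = enum-injective _ _ (begin
      enum (index (x * enum i₀))  ≈⟨ enum∘index _ ⟩
      x * enum i₀                 ≈⟨ *-congˡ (enum∘index 0#) ⟩
      x * 0#                      ≈⟨ zeroʳ x ⟩
      0#                          ≈⟨ enum∘index 0# ⟨
      enum i₀                     ∎)

    units∘ρ≈x*units : ∀ j → units (remove i₀ π ⟨$⟩ʳ j) ≈ x * units j
    units∘ρ≈x*units j = begin
      enum (punchIn i₀ (remove i₀ π ⟨$⟩ʳ j))            ≡⟨ ≡.cong (λ i → enum (punchIn i (remove i₀ π ⟨$⟩ʳ j))) π-fixes-i₀ ⟨
      enum (punchIn (π ⟨$⟩ʳ i₀) (remove i₀ π ⟨$⟩ʳ j))   ≡⟨ ≡.cong enum (punchIn-permute π i₀ j) ⟨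
      enum (π ⟨$⟩ʳ punchIn i₀ j)                        ≈⟨ enum∘index _ ⟩
      x * units j                                       ∎

  ^-periodic : ∀ x e k → x ^ suc (e ℕ.+ n ℕ.* k) ≈ x ^ suc e
  ^-periodic x e k with ≈-dec x 0#
  ... | yes x≈0 = trans (x≈0⇒x^[1+n]≈0 (e ℕ.+ n ℕ.* k) x≈0) (sym (x≈0⇒x^[1+n]≈0 e x≈0))
  ... | no x≉0 = begin
    x ^ (suc e ℕ.+ n ℕ.* k)      ≈⟨ ^-homo-* x (suc e) (n ℕ.* k) ⟩
    x ^ suc e * x ^ (n ℕ.* k)    ≈⟨ *-congˡ (^-assocʳ x n k) ⟨
    x ^ suc e * (x ^ n) ^ k      ≈⟨ *-congˡ (trans (^-congˡ k (fermat x≉0)) (1^n≈1 k)) ⟩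
    x ^ suc e * 1#               ≈⟨ *-identityʳ _ ⟩
    x ^ suc e                    ∎

  characteristic-two : 2 ∣ suc n → HasCharacteristicTwo 𝔽
  characteristic-two (divides k 1+n≡k*2) = begin
    1# + 1#    ≈⟨ +-congˡ -1≈1 ⟨
    1# + - 1#  ≈⟨ -‿inverseʳ 1# ⟩
    0#         ∎
    where
    -1≉0 : ¬ - 1# ≈ 0#
    -1≉0 -1≈0 = 1≉0 (-‿injective (trans -1≈0 (sym -0#≈0#)))

    [-1]²≈1 : (- 1#) ^ 2 ≈ 1#
    [-1]²≈1 = trans (*-congˡ (*-identityʳ _)) (trans (-1*x≈-x (- 1#)) (-‿involutive 1#))

    -1≈1 : - 1# ≈ 1#
    -1≈1 = begin
      - 1#                ≈⟨ *-identityʳ _ ⟨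
      - 1# * 1#           ≈⟨ *-congˡ (fermat -1≉0) ⟨
      (- 1#) ^ suc n      ≡⟨ ≡.cong ((- 1#) ^_) (≡.trans 1+n≡k*2 (ℕₚ.*-comm k 2)) ⟩
      (- 1#) ^ (2 ℕ.* k)  ≈⟨ ^-assocʳ (- 1#) 2 k ⟨
      ((- 1#) ^ 2) ^ k    ≈⟨ ^-congˡ k [-1]²≈1 ⟩
      1# ^ k              ≈⟨ 1^n≈1 k ⟩
      1#                  ∎

n+3*Q+e≡n+e+Q*3 : ∀ n Q e → n ℕ.+ 3 ℕ.* Q ℕ.+ e ≡ n ℕ.+ e ℕ.+ Q ℕ.* 3
n+3*Q+e≡n+e+Q*3 = solve-∀

n+[m+k*Q]*[q+1]≡n+m*[q+1]+[q²-1]*k : ∀ n m k Q →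
  n ℕ.+ (m ℕ.+ k ℕ.* Q) ℕ.* (suc Q ℕ.+ 1) ≡ n ℕ.+ m ℕ.* (suc Q ℕ.+ 1) ℕ.+ (Q ℕ.+ Q ℕ.* suc Q) ℕ.* k
n+[m+k*Q]*[q+1]≡n+m*[q+1]+[q²-1]*k = solve-∀

module FieldOfOrder-q² {c ℓ} (𝔽 : CommutativeRing c ℓ) (isField : IsField 𝔽)
                (t Q : ℕ) (2^t≡q : 2 ℕ.^ t ≡ suc Q) (2∣q : 2 ∣ suc Q)
                (card : HasCardinality 𝔽 (suc Q ℕ.* suc Q)) where
  open CommutativeRing 𝔽
  open RingProperties 𝔽
  open FieldProperties 𝔽 isField
  open FiniteField 𝔽 isField (Q ℕ.+ Q ℕ.* suc Q) card
  open import Algebra.Properties.Semiring.Exp semiring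
  open import Relation.Binary.Reasoning.Setoid setoid

  q : ℕ
  q = suc Q

  1+1≈0 : HasCharacteristicTwo 𝔽
  1+1≈0 = characteristic-two (∣m⇒∣m*n q 2∣q)

  open CharacteristicTwo 𝔽 1+1≈0

  q-additive : AdditivePower q
  q-additive = ≡.subst AdditivePower 2^t≡q (frobenius t)

  x^Q*[x^Q]^q≈1 : ∀ {x} → ¬ x ≈ 0# → x ^ Q * (x ^ Q) ^ q ≈ 1#
  x^Q*[x^Q]^q≈1 {x} x≉0 = begin
    (x ^ Q) ^ suc q           ≈⟨ ^-assocʳ x Q (suc q) ⟩
    x ^ (Q ℕ.* suc q)         ≡⟨ ≡.cong (x ^_) (ℕₚ.*-suc Q q) ⟩
    x ^ (Q ℕ.+ Q ℕ.* suc Q)   ≈⟨ fermat x≉0 ⟩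
    1#                        ∎

  x^[1+n+m′[q+1]]≈x^[1+n+m[q+1]] : ∀ n′ {m m′} → m ℕ.≤ m′ → Q ∣ m′ ℕ.∸ m → ∀ x →
                                   x ^ (suc n′ ℕ.+ m′ ℕ.* (q ℕ.+ 1)) ≈ x ^ (suc n′ ℕ.+ m ℕ.* (q ℕ.+ 1))
  x^[1+n+m′[q+1]]≈x^[1+n+m[q+1]] n′ {m} {m′} m≤m′ (divides k m′∸m≡k*Q) x = begin
    x ^ (suc n′ ℕ.+ m′ ℕ.* (q ℕ.+ 1))                           ≡⟨ ≡.cong (λ j → x ^ (suc n′ ℕ.+ j ℕ.* (q ℕ.+ 1))) m′≡m+k*Q ⟩
    x ^ (suc n′ ℕ.+ (m ℕ.+ k ℕ.* Q) ℕ.* (q ℕ.+ 1))              ≡⟨ ≡.cong (x ^_) (n+[m+k*Q]*[q+1]≡n+m*[q+1]+[q²-1]*k (suc n′) m k Q) ⟩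
    x ^ (suc n′ ℕ.+ m ℕ.* (q ℕ.+ 1) ℕ.+ (Q ℕ.+ Q ℕ.* q) ℕ.* k)  ≈⟨ ^-periodic x (n′ ℕ.+ m ℕ.* (q ℕ.+ 1)) k ⟩
    x ^ (suc n′ ℕ.+ m ℕ.* (q ℕ.+ 1))                            ∎
    where
    m′≡m+k*Q : m′ ≡ m ℕ.+ k ℕ.* Q
    m′≡m+k*Q = ≡.trans (≡.sym (ℕₚ.m+[n∸m]≡n m≤m′)) (≡.cong (m ℕ.+_) m′∸m≡k*Q)

  x^[1+n+m[q+1]]-mod-Q : ∀ n′ m m′ → Q ∣ ∣ m′ - m ∣ → ∀ x →
                         x ^ (suc n′ ℕ.+ m ℕ.* (q ℕ.+ 1)) ≈ x ^ (suc n′ ℕ.+ m′ ℕ.* (q ℕ.+ 1))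
  x^[1+n+m[q+1]]-mod-Q n′ m m′ Q∣∣m′-m∣ x with ℕₚ.≤-total m m′
  ... | inj₁ m≤m′ = sym (x^[1+n+m′[q+1]]≈x^[1+n+m[q+1]] n′ m≤m′ (≡.subst (Q ∣_) (ℕₚ.m≤n⇒∣n-m∣≡n∸m m≤m′) Q∣∣m′-m∣) x)
  ... | inj₂ m′≤m = x^[1+n+m′[q+1]]≈x^[1+n+m[q+1]] n′ m′≤m (≡.subst (Q ∣_) (ℕₚ.m≤n⇒∣m-n∣≡n∸m m′≤m) Q∣∣m′-m∣) x

  module _ {β} (β-root : RootOfX²+X+1 β) (β^q≉β : ¬ β ^ q ≈ β) where

    β^q≈β+1 : β ^ q ≈ β + 1#
    β^q≈β+1 = distinct-roots⇒y≈x+1 1+1≈0 β-root (root⇒x^p-root q q-additive β-root) β^q≉β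

    [β+1]^q≈β+1+1 : (β + 1#) ^ q ≈ β + 1# + 1#
    [β+1]^q≈β+1+1 = trans (q-additive β 1#) (+-cong β^q≈β+1 (1^n≈1 q))

    module _ {y} (y*y^q≈1 : y * y ^ q ≈ 1#) where

      y*[y+β+1]^q≈β*[y+β+1] : y * (y + β + 1#) ^ q ≈ β * (y + β + 1#)
      y*[y+β+1]^q≈β*[y+β+1] = begin
        y * (y + β + 1#) ^ q            ≈⟨ *-congˡ (^-congˡ q (+-assoc y β 1#)) ⟩
        y * (y + (β + 1#)) ^ q          ≈⟨ y*[y+z]^p≈[z+1]*[y+z] q q-additive y*y^q≈1 (root⇒[x+1]-root β-root) [β+1]^q≈β+1+1 ⟩
        (β + 1# + 1#) * (y + (β + 1#))  ≈⟨ *-cong (x+1+1≈x β) (sym (+-assoc y β 1#)) ⟩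
        β * (y + β + 1#)                ∎

      y*[y+β]^q≈[β+1]*[y+β] : y * (y + β) ^ q ≈ (β + 1#) * (y + β)
      y*[y+β]^q≈[β+1]*[y+β] = y*[y+z]^p≈[z+1]*[y+z] q q-additive y*y^q≈1 β-root β^q≈β+1

      y³*M[1+n+3Q]≈M[1+n] : ∀ n′ → y ^ 3 * M 𝔽 β (suc n′ ℕ.+ 3 ℕ.* Q) y ≈ M 𝔽 β (suc n′) y
      y³*M[1+n+3Q]≈M[1+n] n′ = trans (distribˡ (y ^ 3) _ _) (+-cong
        (y^k*a^[1+n+k*Q]≈a^[1+n] Q 3 y*[y+β+1]^q≈β*[y+β+1] (root⇒x³≈1 β-root) n′)
        (y^k*a^[1+n+k*Q]≈a^[1+n] Q 3 y*[y+β]^q≈[β+1]*[y+β] (root⇒x³≈1 (root⇒[x+1]-root β-root)) n′))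

    M-shift-by-3Q : ∀ n′ m x → x ^ (suc n′ ℕ.+ 3 ℕ.* Q ℕ.+ m ℕ.* (q ℕ.+ 1)) * M 𝔽 β (suc n′ ℕ.+ 3 ℕ.* Q) (x ^ Q)
                       ≈ x ^ (suc n′ ℕ.+ m ℕ.* (q ℕ.+ 1)) * M 𝔽 β (suc n′) (x ^ Q)
    M-shift-by-3Q n′ m x with ≈-dec x 0#
    ... | yes x≈0 = trans (x^[1+k]*z≈0 (n′ ℕ.+ 3 ℕ.* Q ℕ.+ e)) (sym (x^[1+k]*z≈0 (n′ ℕ.+ e)))
      where
      e : ℕ
      e = m ℕ.* (q ℕ.+ 1)

      x^[1+k]*z≈0 : ∀ k {z} → x ^ suc k * z ≈ 0#
      x^[1+k]*z≈0 k {z} = trans (*-congʳ (x≈0⇒x^[1+n]≈0 k x≈0)) (zeroˡ z)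
    ... | no x≉0 = begin
      x ^ (n ℕ.+ 3 ℕ.* Q ℕ.+ e) * M 𝔽 β (n ℕ.+ 3 ℕ.* Q) y      ≡⟨ ≡.cong (λ k → x ^ k * M 𝔽 β (n ℕ.+ 3 ℕ.* Q) y) (n+3*Q+e≡n+e+Q*3 n Q e) ⟩
      x ^ (n ℕ.+ e ℕ.+ Q ℕ.* 3) * M 𝔽 β (n ℕ.+ 3 ℕ.* Q) y      ≈⟨ *-congʳ (^-homo-* x (n ℕ.+ e) (Q ℕ.* 3)) ⟩
      x ^ (n ℕ.+ e) * x ^ (Q ℕ.* 3) * M 𝔽 β (n ℕ.+ 3 ℕ.* Q) y  ≈⟨ *-congʳ (*-congˡ (^-assocʳ x Q 3)) ⟨
      x ^ (n ℕ.+ e) * y ^ 3 * M 𝔽 β (n ℕ.+ 3 ℕ.* Q) y          ≈⟨ *-assoc _ _ _ ⟩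
      x ^ (n ℕ.+ e) * (y ^ 3 * M 𝔽 β (n ℕ.+ 3 ℕ.* Q) y)        ≈⟨ *-congˡ (y³*M[1+n+3Q]≈M[1+n] (x^Q*[x^Q]^q≈1 x≉0) n′) ⟩
      x ^ (n ℕ.+ e) * M 𝔽 β n y                                ∎
      where
      n e : ℕ
      n = suc n′
      e = m ℕ.* (q ℕ.+ 1)

      y : Carrier
      y = x ^ Q

open import Data.Nat using (_+_; _*_; _∸_; _^_; _≤_)

mainTheorem6 : ∀ {c ℓ} (t : ℕ) → (∃ λ s → t ≡ suc (2 * s)) →
    (𝔽 : CommutativeRing c ℓ) → IsField 𝔽 → HasCardinality 𝔽 ((2 ^ t) * (2 ^ t)) →
    let module F = CommutativeRing 𝔽
        q = 2 ^ t
        _^F_ = pow 𝔽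
    in (β : F.Carrier) → (((β ^F 2) F.+ β) F.+ F.1#) F.≈ F.0# → ¬ ((β ^F q) F.≈ β) →
    (n m : ℕ) → 1 ≤ n → n ≤ 3 * (q ∸ 1) → 1 ≤ m → m ≤ q ∸ 1 →
    (∀ x → ((x ^F (n + 3 * (q ∸ 1) + m * (q + 1))) F.* M 𝔽 β (n + 3 * (q ∸ 1)) (x ^F (q ∸ 1)))
           F.≈ ((x ^F (n + m * (q + 1))) F.* M 𝔽 β n (x ^F (q ∸ 1))))
    × (∀ m′ → 1 ≤ m′ → (q ∸ 1) ∣ ∣ m′ - m ∣ →
       ∀ x → ((x ^F (n + m * (q + 1))) F.* M 𝔽 β n x) F.≈ ((x ^F (n + m′ * (q + 1))) F.* M 𝔽 β n x))
mainTheorem6 t (s , t≡1+2s) 𝔽 isField card β β-root β^q≉β (suc n′) m _ _ _ _ with 2 ^ t in 2^t≡q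
... | zero  = ⊥-elim (ℕₚ.<⇒≢ (ℕₚ.m^n>0 2 t) (≡.sym 2^t≡q))
... | suc Q = M-shift-by-3Q β-root β^q≉β n′ m ,
              λ m′ _ Q∣∣m′-m∣ x → *-congʳ (x^[1+n+m[q+1]]-mod-Q n′ m m′ Q∣∣m′-m∣ x)
  where
  2∣2^t : 2 ∣ 2 ^ t
  2∣2^t = ≡.subst (λ t → 2 ∣ 2 ^ t) (≡.sym t≡1+2s) (m∣m*n (2 ^ (2 * s)))

  open CommutativeRing 𝔽 using (*-congʳ)
  open FieldOfOrder-q² 𝔽 isField t Q 2^t≡q (≡.subst (2 ∣_) 2^t≡q 2∣2^t) card
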